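{- Let $w,x,y,z$ be binary sequences of the same length $N$. Then $\big(\mathscr{G}(w,x),\mathscr{G}(y,z)\big)$ is a quaternary Legendre pair if and only if $(w,x)$ and $(y,z)$ form an amicable set and $R_w(u)+R_x(u)+R_y(u)+R_z(u)=-4$ for all $u\in\{1,\dots,N-1\}$.
   Context: Let $i$ denote the principal square root of $-1$. A sequence of length $N$ is an $N$-tuple $a=(a_0,\dots,a_{N-1})$ of complex numbers; it is quaternary if every $a_k \in \{+1,i,-1,-i\}$ and binary if every $a_k\in\{+1,-1\}$. For sequences $a,b$ of length $N$, the periodic cross-correlation is $R_{a,b}(u)=\sum_{k=0}^{N-1}a_k\overline{b_{k+u}}$ for $u=0,\dots,N-1$ (indices modulo $N$), and $R_a(u)=R_{a,a}(u)$. A pair $(a,b)$ of quaternary sequences of length $N$ is a Legendre pair if $R_a(u)+R_b(u)=-2$ for all $u\neq 0$. Two pairs $(w,x)$ and $(y,z)$ of binary sequences of the same length form an amicable set if $R_{w,x}(u)+R_{y,z}(u)=R_{x,w}(u)+R_{z,y}(u)$ for all $u\neq 0$. For binary sequences $w,x$ of length $N$, $\mathscr{G}(w,x)$ is the quaternary sequence of length $N$ given by $\mathscr{G}(w,x)=\tfrac12(1+i)w+\tfrac12(1-i)x$ (entrywise). -}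

module Defs where

open import Data.Nat as ℕ using (ℕ; zero; suc)
open import Data.Nat.DivMod using (_%_; m%n<n)
open import Data.Integer using (+_)
open import Data.Rational as ℚ using (ℚ; 0ℚ; 1ℚ; ½; _/_)
open import Data.Fin using (Fin; toℕ; fromℕ<)
open import Data.Sum using (_⊎_)
open import Data.Product using (_×_)
open import Relation.Binary.PropositionalEquality using (_≡_; _≢_)

-- Complex numbers with rational real and imaginary parts (all quantities
-- in the statement lie in ℚ(i)).
record ℂ : Set where
  constructor _+i_
  field
    re : ℚ
    im : ℚ
open ℂ public

infixl 6 _⊕_
infixl 7 _⊗_

_⊕_ : ℂ → ℂ → ℂ
(a +i b) ⊕ (c +i d) = (a ℚ.+ c) +i (b ℚ.+ d)

_⊗_ : ℂ → ℂ → ℂ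
(a +i b) ⊗ (c +i d) = ((a ℚ.* c) ℚ.- (b ℚ.* d)) +i ((a ℚ.* d) ℚ.+ (b ℚ.* c))

conj : ℂ → ℂ
conj (a +i b) = a +i (ℚ.- b)

fromℚ : ℚ → ℂ
fromℚ q = q +i 0ℚ

0ℂ 1ℂ iℂ -1ℂ -iℂ : ℂ
0ℂ = 0ℚ +i 0ℚ
1ℂ = 1ℚ +i 0ℚ
iℂ = 0ℚ +i 1ℚ
-1ℂ = (ℚ.- 1ℚ) +i 0ℚ
-iℂ = 0ℚ +i (ℚ.- 1ℚ)

Seq : ℕ → Set
Seq N = Fin N → ℂ

Quaternary : ∀ {N} → Seq N → Set
Quaternary a = ∀ k → (a k ≡ 1ℂ) ⊎ ((a k ≡ iℂ) ⊎ ((a k ≡ -1ℂ) ⊎ (a k ≡ -iℂ)))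

Binary : ∀ {N} → Seq N → Set
Binary a = ∀ k → (a k ≡ 1ℂ) ⊎ (a k ≡ -1ℂ)

Σ : ∀ N → (Fin N → ℂ) → ℂ
Σ zero    f = 0ℂ
Σ (suc N) f = f Fin.zero ⊕ Σ N (λ k → f (Fin.suc k))

_+ₘ_ : ∀ {N} → Fin N → Fin N → Fin N
_+ₘ_ {suc n} k u = fromℕ< (m%n<n (toℕ k ℕ.+ toℕ u) (suc n))

R₂ : ∀ {N} → Seq N → Seq N → Fin N → ℂ
R₂ {N} a b u = Σ N (λ k → a k ⊗ conj (b (k +ₘ u)))

R : ∀ {N} → Seq N → Fin N → ℂ
R a = R₂ a a

LegendrePair : ∀ {N} → Seq N → Seq N → Set
LegendrePair {N} a b =
  Quaternary a × Quaternary b ×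
  (∀ (u : Fin N) → toℕ u ≢ 0 → R a u ⊕ R b u ≡ fromℚ (ℚ.- (+ 2 / 1)))

Amicable : ∀ {N} → Seq N → Seq N → Seq N → Seq N → Set
Amicable {N} w x y z =
  ∀ (u : Fin N) → toℕ u ≢ 0 → R₂ w x u ⊕ R₂ y z u ≡ R₂ x w u ⊕ R₂ z y u

𝒢 : ∀ {N} → Seq N → Seq N → Seq N
𝒢 w x k = ((½ +i ½) ⊗ w k) ⊕ ((½ +i (ℚ.- ½)) ⊗ x k)

{-# OPTIONS --safe #-}
module Submission where

open import Defs
open import Data.Nat using (ℕ; zero; suc)
open import Data.Integer using (+_)
open import Data.Rational as ℚ using (ℚ; _/_; ½; 0ℚ)
import Data.Rational.Properties as ℚ
open import Data.Rational.Solver using (module +-*-Solver)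
open import Data.Fin using (Fin; toℕ)
open import Data.Product using (_×_; _,_; proj₁; proj₂)
open import Data.Sum using (_⊎_; inj₁; inj₂; [_,_]′)
open import Function.Base using (_∘_)
open import Function.Bundles using (_⇔_; mk⇔; Equivalence)
open import Relation.Binary.PropositionalEquality
  using (_≡_; _≢_; refl; sym; trans; cong; cong₂; module ≡-Reasoning)

open +-*-Solver using (Polynomial; solve; _:=_; _:+_; _:*_; :-_; _:-_; con)

-- With α = ½(1+i) we have 𝒢(p,q) = αp + ᾱq, and αᾱ = ½, α² = i/2, so for
-- arbitrary complex sequences
--   R_{𝒢(w,x)} = ½(R_w + R_x) + (i/2)(R_{w,x} − R_{x,w}).
-- For binary sequences every correlation on the right is real, so the
-- Legendre condition R_{𝒢(w,x)} + R_{𝒢(y,z)} = −2 splits into its real part,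
-- R_w + R_x + R_y + R_z = −4, and its imaginary part, the amicability
-- condition.

ℂ-≡ : ∀ {a b : ℂ} → re a ≡ re b → im a ≡ im b → a ≡ b
ℂ-≡ = cong₂ _+i_

-- Each operation mirrors its
-- counterpart in Defs clause by clause, so a polynomial evaluates
-- definitionally to the corresponding complex expression and each component
-- of a complex identity is a single `solve`.
record ℂₚ (n : ℕ) : Set where
  constructor _+iₚ_
  field
    reₚ imₚ : Polynomial n
open ℂₚ

module _ {n : ℕ} where
  infixl 6 _⊕ₚ_
  infixl 7 _⊗ₚ_

  _⊕ₚ_ : ℂₚ n → ℂₚ n → ℂₚ n
  (a +iₚ b) ⊕ₚ (c +iₚ d) = (a :+ c) +iₚ (b :+ d)

  _⊗ₚ_ : ℂₚ n → ℂₚ n → ℂₚ n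
  (a +iₚ b) ⊗ₚ (c +iₚ d) = ((a :* c) :- (b :* d)) +iₚ ((a :* d) :+ (b :* c))

  conjₚ : ℂₚ n → ℂₚ n
  conjₚ (a +iₚ b) = a +iₚ (:- b)

  conₚ : ℂ → ℂₚ n
  conₚ (a +i b) = con a +iₚ con b

  realₚ : Polynomial n → ℂₚ n
  realₚ a = a +iₚ con 0ℚ

⊕-interchange : ∀ a b c d → (a ⊕ b) ⊕ (c ⊕ d) ≡ (a ⊕ c) ⊕ (b ⊕ d)
⊕-interchange a b c d = ℂ-≡
  (solve 4 (λ a b c d → a :+ b :+ (c :+ d) := a :+ c :+ (b :+ d)) refl
     (re a) (re b) (re c) (re d))
  (solve 4 (λ a b c d → a :+ b :+ (c :+ d) := a :+ c :+ (b :+ d)) refl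
     (im a) (im b) (im c) (im d))

⊗-distribˡ-⊕ : ∀ c a b → c ⊗ (a ⊕ b) ≡ c ⊗ a ⊕ c ⊗ b
⊗-distribˡ-⊕ c a b = ℂ-≡
  (solve 6 (λ c c' a a' b b' → reₚ (lhs (c +iₚ c') (a +iₚ a') (b +iₚ b'))
                            := reₚ (rhs (c +iₚ c') (a +iₚ a') (b +iₚ b'))) refl
     (re c) (im c) (re a) (im a) (re b) (im b))
  (solve 6 (λ c c' a a' b b' → imₚ (lhs (c +iₚ c') (a +iₚ a') (b +iₚ b'))
                            := imₚ (rhs (c +iₚ c') (a +iₚ a') (b +iₚ b'))) refl
     (re c) (im c) (re a) (im a) (re b) (im b))
  where
  lhs rhs : ∀ {n} → ℂₚ n → ℂₚ n → ℂₚ n → ℂₚ n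
  lhs c a b = c ⊗ₚ (a ⊕ₚ b)
  rhs c a b = c ⊗ₚ a ⊕ₚ c ⊗ₚ b

⊗-zeroʳ : ∀ c → c ⊗ 0ℂ ≡ 0ℂ
⊗-zeroʳ c = ℂ-≡
  (solve 2 (λ c c' → reₚ ((c +iₚ c') ⊗ₚ conₚ 0ℂ) := con 0ℚ) refl (re c) (im c))
  (solve 2 (λ c c' → imₚ ((c +iₚ c') ⊗ₚ conₚ 0ℂ) := con 0ℚ) refl (re c) (im c))

½ℂ i½ : ℂ
½ℂ = fromℚ ½
i½ = 0ℚ +i ½

𝒢-mul-conj : ∀ {N} (w x : Seq N) (k l : Fin N) →
  𝒢 w x k ⊗ conj (𝒢 w x l) ≡
  ½ℂ ⊗ (w k ⊗ conj (w l) ⊕ x k ⊗ conj (x l)) ⊕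
  i½ ⊗ (w k ⊗ conj (x l) ⊕ -1ℂ ⊗ (x k ⊗ conj (w l)))
𝒢-mul-conj w x k l = ℂ-≡
  (solve 8 (λ a a' b b' c c' d d' →
       reₚ (lhs (a +iₚ a') (b +iₚ b') (c +iₚ c') (d +iₚ d'))
    := reₚ (rhs (a +iₚ a') (b +iₚ b') (c +iₚ c') (d +iₚ d'))) refl
     (re (w k)) (im (w k)) (re (x k)) (im (x k)) (re (w l)) (im (w l)) (re (x l)) (im (x l)))
  (solve 8 (λ a a' b b' c c' d d' →
       imₚ (lhs (a +iₚ a') (b +iₚ b') (c +iₚ c') (d +iₚ d'))
    := imₚ (rhs (a +iₚ a') (b +iₚ b') (c +iₚ c') (d +iₚ d'))) refl
     (re (w k)) (im (w k)) (re (x k)) (im (x k)) (re (w l)) (im (w l)) (re (x l)) (im (x l)))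
  where
  𝒢ₚ : ∀ {n} → ℂₚ n → ℂₚ n → ℂₚ n
  𝒢ₚ p q = conₚ (½ +i ½) ⊗ₚ p ⊕ₚ conₚ (½ +i (ℚ.- ½)) ⊗ₚ q
  lhs rhs : ∀ {n} → ℂₚ n → ℂₚ n → ℂₚ n → ℂₚ n → ℂₚ n
  lhs p q p' q' = 𝒢ₚ p q ⊗ₚ conjₚ (𝒢ₚ p' q')
  rhs p q p' q' = conₚ ½ℂ ⊗ₚ (p ⊗ₚ conjₚ p' ⊕ₚ q ⊗ₚ conjₚ q') ⊕ₚ
                  conₚ i½ ⊗ₚ (p ⊗ₚ conjₚ q' ⊕ₚ conₚ -1ℂ ⊗ₚ (q ⊗ₚ conjₚ p'))

Σ-cong : ∀ N {f g : Fin N → ℂ} → (∀ k → f k ≡ g k) → Σ N f ≡ Σ N g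
Σ-cong zero    f≡g = refl
Σ-cong (suc N) f≡g = cong₂ _⊕_ (f≡g Fin.zero) (Σ-cong N (f≡g ∘ Fin.suc))

Σ-⊕ : ∀ N (f g : Fin N → ℂ) → Σ N (λ k → f k ⊕ g k) ≡ Σ N f ⊕ Σ N g
Σ-⊕ zero    f g = refl
Σ-⊕ (suc N) f g = trans (cong (f Fin.zero ⊕ g Fin.zero ⊕_) (Σ-⊕ N (f ∘ Fin.suc) (g ∘ Fin.suc)))
                        (⊕-interchange (f Fin.zero) (g Fin.zero) (Σ N (f ∘ Fin.suc)) (Σ N (g ∘ Fin.suc)))

Σ-⊗ˡ : ∀ N c (f : Fin N → ℂ) → Σ N (λ k → c ⊗ f k) ≡ c ⊗ Σ N f
Σ-⊗ˡ zero    c f = sym (⊗-zeroʳ c)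
Σ-⊗ˡ (suc N) c f = trans (cong (c ⊗ f Fin.zero ⊕_) (Σ-⊗ˡ N c (f ∘ Fin.suc)))
                         (sym (⊗-distribˡ-⊕ c (f Fin.zero) (Σ N (f ∘ Fin.suc))))

R-𝒢 : ∀ {N} (w x : Seq N) u →
  R (𝒢 w x) u ≡ ½ℂ ⊗ (R w u ⊕ R x u) ⊕ i½ ⊗ (R₂ w x u ⊕ -1ℂ ⊗ R₂ x w u)
R-𝒢 {N} w x u = begin
  R (𝒢 w x) u
    ≡⟨ Σ-cong N (λ k → 𝒢-mul-conj w x k (k +ₘ u)) ⟩
  Σ N (λ k → ½ℂ ⊗ (w k ⊗ conj (w (k +ₘ u)) ⊕ x k ⊗ conj (x (k +ₘ u))) ⊕
             i½ ⊗ (w k ⊗ conj (x (k +ₘ u)) ⊕ -1ℂ ⊗ (x k ⊗ conj (w (k +ₘ u)))))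
    ≡⟨ Σ-⊕ N _ _ ⟩
  Σ N (λ k → ½ℂ ⊗ (w k ⊗ conj (w (k +ₘ u)) ⊕ x k ⊗ conj (x (k +ₘ u)))) ⊕
  Σ N (λ k → i½ ⊗ (w k ⊗ conj (x (k +ₘ u)) ⊕ -1ℂ ⊗ (x k ⊗ conj (w (k +ₘ u)))))
    ≡⟨ cong₂ _⊕_ (Σ-⊗ˡ N ½ℂ _) (Σ-⊗ˡ N i½ _) ⟩
  ½ℂ ⊗ Σ N (λ k → w k ⊗ conj (w (k +ₘ u)) ⊕ x k ⊗ conj (x (k +ₘ u))) ⊕
  i½ ⊗ Σ N (λ k → w k ⊗ conj (x (k +ₘ u)) ⊕ -1ℂ ⊗ (x k ⊗ conj (w (k +ₘ u))))
    ≡⟨ cong₂ (λ s t → ½ℂ ⊗ s ⊕ i½ ⊗ t)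
         (Σ-⊕ N _ _) (trans (Σ-⊕ N _ _) (cong (R₂ w x u ⊕_) (Σ-⊗ˡ N -1ℂ _))) ⟩
  ½ℂ ⊗ (R w u ⊕ R x u) ⊕ i½ ⊗ (R₂ w x u ⊕ -1ℂ ⊗ R₂ x w u) ∎
  where open ≡-Reasoning

IsReal : ℂ → Set
IsReal a = im a ≡ 0ℚ

⊕-real : ∀ a b → IsReal a → IsReal b → IsReal (a ⊕ b)
⊕-real a b a-real b-real = cong₂ ℚ._+_ a-real b-real

⊗-conj-real : ∀ a b → IsReal a → IsReal b → IsReal (a ⊗ conj b)
⊗-conj-real (a +i _) (b +i _) refl refl =
  solve 2 (λ a b → imₚ (realₚ a ⊗ₚ conjₚ (realₚ b)) := con 0ℚ) refl a b

Σ-real : ∀ N {f : Fin N → ℂ} → (∀ k → IsReal (f k)) → IsReal (Σ N f)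
Σ-real zero    f-real = refl
Σ-real (suc N) {f} f-real =
  ⊕-real (f Fin.zero) (Σ N (f ∘ Fin.suc)) (f-real Fin.zero) (Σ-real N (f-real ∘ Fin.suc))

binary-real : ∀ {p} → (p ≡ 1ℂ) ⊎ (p ≡ -1ℂ) → IsReal p
binary-real = [ cong im , cong im ]′

R₂-binary-real : ∀ {N} (a b : Seq N) → Binary a → Binary b → ∀ u → IsReal (R₂ a b u)
R₂-binary-real {N} a b a-binary b-binary u = Σ-real N (λ k →
  ⊗-conj-real (a k) (b (k +ₘ u)) (binary-real (a-binary k)) (binary-real (b-binary (k +ₘ u))))

real-≡ : ∀ {a b} → IsReal a → IsReal b → re a ≡ re b → a ≡ b
real-≡ a-real b-real re-eq = ℂ-≡ re-eq (trans a-real (sym b-real))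

half-combination-real : ∀ a b c d → IsReal a → IsReal b → IsReal c → IsReal d →
  ½ℂ ⊗ (a ⊕ b) ⊕ i½ ⊗ (c ⊕ -1ℂ ⊗ d) ≡
  (½ ℚ.* (re a ℚ.+ re b)) +i (½ ℚ.* (re c ℚ.- re d))
half-combination-real (a +i _) (b +i _) (c +i _) (d +i _) refl refl refl refl = ℂ-≡
  (solve 4 (λ a b c d → reₚ (lhs a b c d) := con ½ :* (a :+ b)) refl a b c d)
  (solve 4 (λ a b c d → imₚ (lhs a b c d) := con ½ :* (c :- d)) refl a b c d)
  where
  lhs : ∀ {n} → Polynomial n → Polynomial n → Polynomial n → Polynomial n → ℂₚ n
  lhs a b c d = conₚ ½ℂ ⊗ₚ (realₚ a ⊕ₚ realₚ b) ⊕ₚ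
                conₚ i½ ⊗ₚ (realₚ c ⊕ₚ conₚ -1ℂ ⊗ₚ realₚ d)

R-𝒢-binary : ∀ {N} {w x : Seq N} → Binary w → Binary x → ∀ u →
  R (𝒢 w x) u ≡
  (½ ℚ.* (re (R w u) ℚ.+ re (R x u))) +i (½ ℚ.* (re (R₂ w x u) ℚ.- re (R₂ x w u)))
R-𝒢-binary {w = w} {x} w-binary x-binary u =
  trans (R-𝒢 w x u)
        (half-combination-real (R w u) (R x u) (R₂ w x u) (R₂ x w u)
           (R₂-binary-real w w w-binary w-binary u) (R₂-binary-real x x x-binary x-binary u)
           (R₂-binary-real w x w-binary x-binary u) (R₂-binary-real x w x-binary w-binary u))

𝒢-quaternary : ∀ {N} {w x : Seq N} → Binary w → Binary x → Quaternary (𝒢 w x)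
𝒢-quaternary {w = w} {x} w-binary x-binary k with w k | w-binary k | x k | x-binary k
... | _ | inj₁ refl | _ | inj₁ refl = inj₁ refl
... | _ | inj₁ refl | _ | inj₂ refl = inj₂ (inj₁ refl)
... | _ | inj₂ refl | _ | inj₂ refl = inj₂ (inj₂ (inj₁ refl))
... | _ | inj₂ refl | _ | inj₁ refl = inj₂ (inj₂ (inj₂ refl))

half-sums≡-2⇔ : ∀ a b c d →
  ½ ℚ.* (a ℚ.+ b) ℚ.+ ½ ℚ.* (c ℚ.+ d) ≡ ℚ.- (+ 2 / 1) ⇔ a ℚ.+ b ℚ.+ c ℚ.+ d ≡ ℚ.- (+ 4 / 1)
half-sums≡-2⇔ a b c d = mk⇔
  (trans (solve 4 (λ a b c d → a :+ b :+ c :+ d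
                            := con (+ 2 / 1) :* (con ½ :* (a :+ b) :+ con ½ :* (c :+ d))) refl a b c d)
   ∘ cong (+ 2 / 1 ℚ.*_))
  (trans (solve 4 (λ a b c d → con ½ :* (a :+ b) :+ con ½ :* (c :+ d)
                            := con ½ :* (a :+ b :+ c :+ d)) refl a b c d)
   ∘ cong (½ ℚ.*_))

half-differences≡0⇔ : ∀ a b c d →
  ½ ℚ.* (a ℚ.- b) ℚ.+ ½ ℚ.* (c ℚ.- d) ≡ 0ℚ ⇔ a ℚ.+ c ≡ b ℚ.+ d
half-differences≡0⇔ a b c d = mk⇔
  (λ eq → trans (solve 4 (λ a b c d → a :+ c
                 := con (+ 2 / 1) :* (con ½ :* (a :- b) :+ con ½ :* (c :- d)) :+ (b :+ d)) refl a b c d)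
                (trans (cong (λ t → + 2 / 1 ℚ.* t ℚ.+ (b ℚ.+ d)) eq) (ℚ.+-identityˡ (b ℚ.+ d))))
  (λ eq → trans (solve 4 (λ a b c d → con ½ :* (a :- b) :+ con ½ :* (c :- d)
                 := con ½ :* ((a :+ c) :- (b :+ d))) refl a b c d)
                (trans (cong (λ t → ½ ℚ.* (t ℚ.- (b ℚ.+ d))) eq)
                       (cong (½ ℚ.*_) (ℚ.+-inverseʳ (b ℚ.+ d)))))

module _ {N} {w x y z : Seq N}
         (w-binary : Binary w) (x-binary : Binary x) (y-binary : Binary y) (z-binary : Binary z)
         (u : Fin N)
         where

  private
    real-part imaginary-part : ℚ
    real-part = ½ ℚ.* (re (R w u) ℚ.+ re (R x u)) ℚ.+ ½ ℚ.* (re (R y u) ℚ.+ re (R z u))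
    imaginary-part = ½ ℚ.* (re (R₂ w x u) ℚ.- re (R₂ x w u)) ℚ.+ ½ ℚ.* (re (R₂ y z u) ℚ.- re (R₂ z y u))

    decomposition : R (𝒢 w x) u ⊕ R (𝒢 y z) u ≡ real-part +i imaginary-part
    decomposition = cong₂ _⊕_ (R-𝒢-binary w-binary x-binary u) (R-𝒢-binary y-binary z-binary u)

    sums : real-part ≡ ℚ.- (+ 2 / 1) ⇔
           re (R w u) ℚ.+ re (R x u) ℚ.+ re (R y u) ℚ.+ re (R z u) ≡ ℚ.- (+ 4 / 1)
    sums = half-sums≡-2⇔ (re (R w u)) (re (R x u)) (re (R y u)) (re (R z u))

    differences : imaginary-part ≡ 0ℚ ⇔ re (R₂ w x u) ℚ.+ re (R₂ y z u) ≡ re (R₂ x w u) ℚ.+ re (R₂ z y u)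
    differences = half-differences≡0⇔ (re (R₂ w x u)) (re (R₂ x w u)) (re (R₂ y z u)) (re (R₂ z y u))

    real : ∀ a b → Binary a → Binary b → IsReal (R₂ a b u)
    real a b a-binary b-binary = R₂-binary-real a b a-binary b-binary u

    amicable-lhs-real : IsReal (R₂ w x u ⊕ R₂ y z u)
    amicable-lhs-real = ⊕-real (R₂ w x u) (R₂ y z u) (real w x w-binary x-binary) (real y z y-binary z-binary)

    amicable-rhs-real : IsReal (R₂ x w u ⊕ R₂ z y u)
    amicable-rhs-real = ⊕-real (R₂ x w u) (R₂ z y u) (real x w x-binary w-binary) (real z y z-binary y-binary)

    sum-real : IsReal (R w u ⊕ R x u ⊕ R y u ⊕ R z u)
    sum-real =
      ⊕-real (R w u ⊕ R x u ⊕ R y u) (R z u)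
        (⊕-real (R w u ⊕ R x u) (R y u)
          (⊕-real (R w u) (R x u) (real w w w-binary w-binary) (real x x x-binary x-binary))
          (real y y y-binary y-binary))
        (real z z z-binary z-binary)

  legendre-condition⇔ :
    R (𝒢 w x) u ⊕ R (𝒢 y z) u ≡ fromℚ (ℚ.- (+ 2 / 1)) ⇔
    (R₂ w x u ⊕ R₂ y z u ≡ R₂ x w u ⊕ R₂ z y u ×
     R w u ⊕ R x u ⊕ R y u ⊕ R z u ≡ fromℚ (ℚ.- (+ 4 / 1)))
  legendre-condition⇔ = mk⇔ to from
    where
    to : R (𝒢 w x) u ⊕ R (𝒢 y z) u ≡ fromℚ (ℚ.- (+ 2 / 1)) →
         R₂ w x u ⊕ R₂ y z u ≡ R₂ x w u ⊕ R₂ z y u ×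
         R w u ⊕ R x u ⊕ R y u ⊕ R z u ≡ fromℚ (ℚ.- (+ 4 / 1))
    to legendre = real-≡ amicable-lhs-real amicable-rhs-real (Equivalence.to differences (cong im parts))
                , real-≡ sum-real refl (Equivalence.to sums (cong re parts))
      where
      parts : real-part +i imaginary-part ≡ fromℚ (ℚ.- (+ 2 / 1))
      parts = trans (sym decomposition) legendre

    from : R₂ w x u ⊕ R₂ y z u ≡ R₂ x w u ⊕ R₂ z y u ×
           R w u ⊕ R x u ⊕ R y u ⊕ R z u ≡ fromℚ (ℚ.- (+ 4 / 1)) →
           R (𝒢 w x) u ⊕ R (𝒢 y z) u ≡ fromℚ (ℚ.- (+ 2 / 1))
    from (amicable , sum) = trans decomposition
      (ℂ-≡ (Equivalence.from sums (cong re sum)) (Equivalence.from differences (cong re amicable)))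

proposition4p1 : (N : ℕ) (w x y z : Seq N) →
    Binary w → Binary x → Binary y → Binary z →
    LegendrePair (𝒢 w x) (𝒢 y z) ⇔
      (Amicable w x y z ×
       (∀ (u : Fin N) → toℕ u ≢ 0 →
          R w u ⊕ R x u ⊕ R y u ⊕ R z u ≡ fromℚ (ℚ.- (+ 4 / 1))))
proposition4p1 N w x y z w-binary x-binary y-binary z-binary = mk⇔ to from
  where
  module Condition u = Equivalence (legendre-condition⇔ w-binary x-binary y-binary z-binary u)

  to : LegendrePair (𝒢 w x) (𝒢 y z) →
       Amicable w x y z × (∀ u → toℕ u ≢ 0 → R w u ⊕ R x u ⊕ R y u ⊕ R z u ≡ fromℚ (ℚ.- (+ 4 / 1)))
  to (_ , _ , legendre) = (λ u u≢0 → proj₁ (Condition.to u (legendre u u≢0)))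
                        , (λ u u≢0 → proj₂ (Condition.to u (legendre u u≢0)))

  from : Amicable w x y z × (∀ u → toℕ u ≢ 0 → R w u ⊕ R x u ⊕ R y u ⊕ R z u ≡ fromℚ (ℚ.- (+ 4 / 1))) →
         LegendrePair (𝒢 w x) (𝒢 y z)
  from (amicable , sum) = 𝒢-quaternary w-binary x-binary , 𝒢-quaternary y-binary z-binary
                        , λ u u≢0 → Condition.from u (amicable u u≢0 , sum u u≢0)
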